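{- Let $(F_r)_{r\in\mathbb{Z}}$ be the Fibonacci numbers and $(\mathcal{F}_r)_{r\in\mathbb{Z}}$ any generalized Fibonacci sequence. Then for every nonnegative integer $k$ and all integers $r,s$, \[ \sum_{j=0}^{k}(-1)^j\binom kjF_{s-1}^{\,k-j}\mathcal{F}_{r-k+sj}=(-1)^kF_s^{\,k}\mathcal{F}_r, \] \[ \sum_{j=0}^{k}\binom kjF_{s-1}^{\,k-j}F_s^{\,j}\mathcal{F}_{r-sk+j}=\mathcal{F}_r, \] and \[ \sum_{j=0}^{k}(-1)^{k-j}\binom kjF_{s+1}^{\,k-j}\mathcal{F}_{r+k+sj}=F_s^{\,k}\mathcal{F}_r. \]
   Context: The Fibonacci numbers $(F_r)_{r\in\mathbb{Z}}$ satisfy $F_0=0$, $F_1=1$ and $F_r=F_{r-1}+F_{r-2}$ for all $r\in\mathbb{Z}$. A generalized Fibonacci sequence is any sequence $(\mathcal{F}_r)_{r\in\mathbb{Z}}$ of complex numbers with $\mathcal{F}_r=\mathcal{F}_{r-1}+\mathcal{F}_{r-2}$ for all $r\in\mathbb{Z}$. The convention $0^0=1$ is used. -}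

module Defs where

open import Level using (Level)
open import Data.Nat as ℕ using (ℕ; zero; suc)
open import Data.Nat.Combinatorics using (_C_)
open import Data.Integer as ℤ using (ℤ; +_; -[1+_])
open import Algebra.Bundles using (CommutativeRing; Semiring)
import Algebra.Definitions.RawSemiring as RS

fibℕ : ℕ → ℕ
fibℕ zero = 0
fibℕ (suc zero) = 1
fibℕ (suc (suc n)) = fibℕ (suc n) ℕ.+ fibℕ n

-- Fibonacci numbers on ℤ, extended to negative indices by the recurrence:
-- F (-(n+1)) = (-1)^n F (n+1)
sgn : ℕ → ℤ
sgn zero = ℤ.+ 1
sgn (suc n) = ℤ.- sgn n

fib : ℤ → ℤ
fib (+ n) = + fibℕ n
fib -[1+ n ] = sgn n ℤ.* (+ fibℕ (suc n))

module FibDefs {c ℓ : Level} (R : CommutativeRing c ℓ) where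
  open CommutativeRing R hiding (Carrier; _≈_; _+_; _*_; -_; 0#; 1#)
  open CommutativeRing R public using (Carrier; _≈_; _+_; _*_; -_; 0#; 1#)
  open RS (Semiring.rawSemiring semiring) public using (_^_)
  open RS (Semiring.rawSemiring semiring) using (_×_)

  fromℤ : ℤ → Carrier
  fromℤ (+ n) = n × 1#
  fromℤ -[1+ n ] = - (suc n × 1#)

  F : ℤ → Carrier
  F r = fromℤ (fib r)

  binom : ℕ → ℕ → Carrier
  binom k j = (k C j) × 1#

  sumTo : ℕ → (ℕ → Carrier) → Carrier
  sumTo zero f = f 0
  sumTo (suc k) f = sumTo k f + f (suc k)

  IsGenFib : (ℤ → Carrier) → Set ℓ
  IsGenFib G = ∀ (r : ℤ) → G r ≈ G (r ℤ.- + 1) + G (r ℤ.- + 2)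

{-# OPTIONS --safe #-}
module Submission where

-- A generalized Fibonacci sequence G satisfies the addition formula
-- G(n + s) = F_s G(n + 1) + F_{s-1} G(n): as functions of s both sides are
-- generalized Fibonacci sequences, and they agree at s = 0 and s = 1.
-- Each of the three identities is the k-th iterate of a two-term relation
-- a G(n) + b G(n + d) = c G(n + e) given by the addition formula, and such a
-- relation iterates binomially, exactly as (a + b Eᵈ)ᵏ = cᵏ Eᵉᵏ for the
-- shift operator E: Σⱼ C(k,j) a^(k-j) bʲ G(n + dj) = cᵏ G(n + ek).

open import Defs
open import Data.Nat using (ℕ; _∸_)
open import Data.Integer using (ℤ; +_) renaming (_+_ to _+ℤ_; _*_ to _*ℤ_; _-_ to _-ℤ_)
open import Data.Product using (_×_)
open import Algebra.Bundles using (CommutativeRing)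

open import Data.Nat as ℕ using (zero; suc; _<_)
import Data.Nat.Properties as ℕ
open import Data.Nat.Combinatorics using (_C_; nCk+nC[k+1]≡[n+1]C[k+1]; k>n⇒nCk≡0)
open import Data.Integer as ℤ using (-[1+_])
import Data.Integer.Properties as ℤ
open import Data.Integer.Tactic.RingSolver using (solve-∀)
open import Data.Product using (_,_; proj₁)
open import Data.Sum using (inj₁; inj₂)
open import Function using (_∘_)
open import Relation.Binary.PropositionalEquality as ≡ using (_≡_)

ℤ-induction : ∀ {p} (P : ℤ → Set p) → P (+ 0) →
  (∀ i → P i → P (i +ℤ + 1)) → (∀ i → P (i +ℤ + 1) → P i) → ∀ i → P i
ℤ-induction P P0 up down (+ zero) = P0
ℤ-induction P P0 up down (+ suc n) =
  ≡.subst P (≡.cong +_ (ℕ.+-comm n 1)) (up (+ n) (ℤ-induction P P0 up down (+ n)))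
ℤ-induction P P0 up down -[1+ zero ] = down -[1+ zero ] P0
ℤ-induction P P0 up down -[1+ suc n ] = down -[1+ suc n ] (ℤ-induction P P0 up down -[1+ n ])

module FibonacciIdentities {c ℓ} (R : CommutativeRing c ℓ) where
  open FibDefs R
  open CommutativeRing R using
    ( refl; sym; trans; reflexive; setoid; +-cong; +-congˡ; +-congʳ; *-cong; *-congˡ; *-congʳ
    ; +-assoc; +-identityˡ; +-identityʳ; -‿cong; -‿inverseˡ; -‿inverseʳ
    ; *-assoc; *-identityˡ; *-identityʳ; distribˡ; zeroˡ; zeroʳ
    ; +-comm; ring; +-monoid; +-group; +-abelianGroup; commutativeSemiring )
  open import Algebra.Properties.Ring ring using (-1*x≈-x; -0#≈0#; -‿involutive; -‿distribˡ-*)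
  open import Algebra.Properties.Group +-group using () renaming (∙-cancelˡ to +-cancelˡ)
  open import Algebra.Properties.AbelianGroup +-abelianGroup using (⁻¹-∙-comm)
  open import Algebra.Properties.Monoid.Mult +-monoid using (×-homo-+) renaming (_×_ to _times_)
  open import Algebra.Properties.CommutativeSemiring.Exp commutativeSemiring
    using (^-congˡ; ^-distrib-*)
  open import Algebra.Solver.Ring.NaturalCoefficients.Default commutativeSemiring
    using (solve; _:=_; _:+_; _:*_)
  open import Relation.Binary.Reasoning.Setoid setoid

  reindex : (H : ℤ → Carrier) {i j : ℤ} → i ≡ j → H i ≈ H j
  reindex H i≡j = reflexive (≡.cong H i≡j)

  -x+[x+y]≈y : ∀ x y → - x + (x + y) ≈ y
  -x+[x+y]≈y x y = begin
    - x + (x + y)  ≈⟨ +-assoc _ _ _ ⟨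
    (- x + x) + y  ≈⟨ +-congʳ (-‿inverseˡ x) ⟩
    0# + y         ≈⟨ +-identityˡ y ⟩
    y              ∎

  1^n≈1 : ∀ n → 1# ^ n ≈ 1#
  1^n≈1 zero = refl
  1^n≈1 (suc n) = trans (*-identityˡ _) (1^n≈1 n)

  [-x]^n≈[-1]^n*x^n : ∀ x n → (- x) ^ n ≈ (- 1#) ^ n * x ^ n
  [-x]^n≈[-1]^n*x^n x n = trans (^-congˡ n (sym (-1*x≈-x x))) (^-distrib-* (- 1#) x n)

  sumTo-cong : ∀ k {f g : ℕ → Carrier} → (∀ j → f j ≈ g j) → sumTo k f ≈ sumTo k g
  sumTo-cong zero f≈g = f≈g 0
  sumTo-cong (suc k) f≈g = +-cong (sumTo-cong k f≈g) (f≈g (suc k))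

  sumTo-distrib-+ : ∀ k (f g : ℕ → Carrier) →
    sumTo k (λ j → f j + g j) ≈ sumTo k f + sumTo k g
  sumTo-distrib-+ zero f g = refl
  sumTo-distrib-+ (suc k) f g =
    trans (+-congʳ (sumTo-distrib-+ k f g))
          (solve 4 (λ x y z w → (x :+ y) :+ (z :+ w) := (x :+ z) :+ (y :+ w)) refl _ _ _ _)

  *-distribˡ-sumTo : ∀ k x (f : ℕ → Carrier) → sumTo k (λ j → x * f j) ≈ x * sumTo k f
  *-distribˡ-sumTo zero x f = refl
  *-distribˡ-sumTo (suc k) x f = trans (+-congʳ (*-distribˡ-sumTo k x f)) (sym (distribˡ _ _ _))

  sumTo-suc : ∀ k (f : ℕ → Carrier) → sumTo (suc k) f ≈ f 0 + sumTo k (f ∘ suc)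
  sumTo-suc zero f = refl
  sumTo-suc (suc k) f = trans (+-congʳ (sumTo-suc k f)) (+-assoc _ _ _)

  binom-suc-suc : ∀ k j → binom (suc k) (suc j) ≈ binom k j + binom k (suc j)
  binom-suc-suc k j =
    trans (reflexive (≡.cong (_times 1#) (≡.sym (nCk+nC[k+1]≡[n+1]C[k+1] k j))))
          (×-homo-+ 1# (k C j) (k C suc j))

  k<j⇒binom≈0 : ∀ {k j} → k < j → binom k j ≈ 0#
  k<j⇒binom≈0 k<j = reflexive (≡.cong (_times 1#) (k>n⇒nCk≡0 k<j))

  binomialTerm : ℕ → Carrier → Carrier → (ℕ → Carrier) → ℕ → Carrier
  binomialTerm k a b u j = binom k j * a ^ (k ∸ j) * b ^ j * u j

  binomialSum : ℕ → Carrier → Carrier → (ℕ → Carrier) → Carrier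
  binomialSum k a b u = sumTo k (binomialTerm k a b u)

  binom-suc*^∸ : ∀ k j a →
    binom k (suc j) * a ^ (k ∸ j) ≈ a * (binom k (suc j) * a ^ (k ∸ suc j))
  binom-suc*^∸ k j a with ℕ.≤-<-connex (suc j) k
  ... | inj₁ j<k rewrite ℕ.+-∸-assoc 1 j<k =
    solve 3 (λ x a y → x :* (a :* y) := a :* (x :* y)) refl _ _ _
  ... | inj₂ k<1+j = trans (vanishes _) (sym (trans (*-congˡ (vanishes _)) (zeroʳ a)))
    where
      vanishes : ∀ y → binom k (suc j) * y ≈ 0#
      vanishes y = trans (*-congʳ (k<j⇒binom≈0 k<1+j)) (zeroˡ y)

  binomialTerm-suc-suc : ∀ k a b u j →
    binomialTerm (suc k) a b u (suc j)
      ≈ b * binomialTerm k a b (u ∘ suc) j + a * binomialTerm k a b u (suc j)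
  binomialTerm-suc-suc k a b u j = begin
    binom (suc k) (suc j) * a ^ (k ∸ j) * (b * b ^ j) * u (suc j)
      ≈⟨ *-congʳ (*-congʳ (*-congʳ (binom-suc-suc k j))) ⟩
    (binom k j + binom k (suc j)) * a ^ (k ∸ j) * (b * b ^ j) * u (suc j)
      ≈⟨ solve 6 (λ x y p b q v → (x :+ y) :* p :* (b :* q) :* v
                                  := b :* (x :* p :* q :* v) :+ y :* p :* (b :* q) :* v)
               refl _ _ _ _ _ _ ⟩
    b * binomialTerm k a b (u ∘ suc) j + binom k (suc j) * a ^ (k ∸ j) * (b * b ^ j) * u (suc j)
      ≈⟨ +-congˡ (*-congʳ (*-congʳ (binom-suc*^∸ k j a))) ⟩
    b * binomialTerm k a b (u ∘ suc) j
      + a * (binom k (suc j) * a ^ (k ∸ suc j)) * (b * b ^ j) * u (suc j)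
      ≈⟨ +-congˡ (solve 4 (λ a p q v → a :* p :* q :* v := a :* (p :* q :* v)) refl _ _ _ _) ⟩
    b * binomialTerm k a b (u ∘ suc) j + a * binomialTerm k a b u (suc j) ∎

  binomialSum-split : ∀ k a b u →
    binomialSum k a b u ≈ binomialTerm k a b u 0 + sumTo k (binomialTerm k a b u ∘ suc)
  binomialSum-split k a b u = begin
    binomialSum k a b u                          ≈⟨ +-identityʳ _ ⟨
    binomialSum k a b u + 0#                     ≈⟨ +-congˡ top-vanishes ⟨
    sumTo (suc k) (binomialTerm k a b u)         ≈⟨ sumTo-suc k _ ⟩
    binomialTerm k a b u 0 + sumTo k (binomialTerm k a b u ∘ suc) ∎
    where
      top-vanishes : binomialTerm k a b u (suc k) ≈ 0#
      top-vanishes =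
        trans (solve 4 (λ x p q v → x :* p :* q :* v := x :* (p :* q :* v)) refl _ _ _ _)
              (trans (*-congʳ (k<j⇒binom≈0 (ℕ.n<1+n k))) (zeroˡ _))

  binomialSum-suc : ∀ k a b u →
    binomialSum (suc k) a b u ≈ a * binomialSum k a b u + b * binomialSum k a b (u ∘ suc)
  binomialSum-suc k a b u = begin
    binomialSum (suc k) a b u
      ≈⟨ sumTo-suc k _ ⟩
    t (suc k) u 0 + sumTo k (t (suc k) u ∘ suc)
      ≈⟨ +-cong (solve 5 (λ p a q r v → p :* (a :* q) :* r :* v := a :* (p :* q :* r :* v))
                        refl _ _ _ _ _)
                (sumTo-cong k (binomialTerm-suc-suc k a b u)) ⟩
    a * t k u 0 + sumTo k (λ j → b * t k (u ∘ suc) j + a * t k u (suc j))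
      ≈⟨ +-congˡ (trans (sumTo-distrib-+ k _ _)
                        (+-cong (*-distribˡ-sumTo k b _) (*-distribˡ-sumTo k a _))) ⟩
    a * t k u 0 + (b * binomialSum k a b (u ∘ suc) + a * sumTo k (t k u ∘ suc))
      ≈⟨ solve 4 (λ a x y z → a :* x :+ (y :+ a :* z) := a :* (x :+ z) :+ y) refl _ _ _ _ ⟩
    a * (t k u 0 + sumTo k (t k u ∘ suc)) + b * binomialSum k a b (u ∘ suc)
      ≈⟨ +-congʳ (*-congˡ (binomialSum-split k a b u)) ⟨
    a * binomialSum k a b u + b * binomialSum k a b (u ∘ suc) ∎
    where
      t : ℕ → (ℕ → Carrier) → ℕ → Carrier
      t k u = binomialTerm k a b u

  binomialSum-cong : ∀ k a b {u v : ℕ → Carrier} →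
    (∀ j → u j ≈ v j) → binomialSum k a b u ≈ binomialSum k a b v
  binomialSum-cong k a b u≈v = sumTo-cong k (λ j → *-congˡ (u≈v j))

  binomialSum-iterate : (H : ℤ → Carrier) {a b c : Carrier} {d e : ℤ} →
    (∀ n → a * H n + b * H (n +ℤ d) ≈ c * H (n +ℤ e)) →
    ∀ k n → binomialSum k a b (λ j → H (n +ℤ d *ℤ + j)) ≈ c ^ k * H (n +ℤ e *ℤ + k)
  binomialSum-iterate H {d = d} {e = e} rel zero n = begin
    (1# + 0#) * 1# * 1# * H (n +ℤ d *ℤ + 0)  ≈⟨ *-congʳ (trans (*-identityʳ _) (*-identityʳ _)) ⟩
    (1# + 0#) * H (n +ℤ d *ℤ + 0)            ≈⟨ *-cong (+-identityʳ 1#) (reindex H (+-*0 n d)) ⟩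
    1# * H n                                 ≈⟨ *-congˡ (reindex H (+-*0 n e)) ⟨
    1# * H (n +ℤ e *ℤ + 0)                   ∎
    where
      +-*0 : ∀ n d → n +ℤ d *ℤ + 0 ≡ n
      +-*0 = solve-∀
  binomialSum-iterate H {a} {b} {c} {d} {e} rel (suc k) n = begin
    binomialSum (suc k) a b (λ j → H (n +ℤ d *ℤ + j))
      ≈⟨ binomialSum-suc k a b _ ⟩
    a * binomialSum k a b (λ j → H (n +ℤ d *ℤ + j))
      + b * binomialSum k a b (λ j → H (n +ℤ d *ℤ + suc j))
      ≈⟨ +-congˡ (*-congˡ (binomialSum-cong k a b (λ j → reindex H (shift-start n d (+ j))))) ⟩
    a * binomialSum k a b (λ j → H (n +ℤ d *ℤ + j))
      + b * binomialSum k a b (λ j → H ((n +ℤ d) +ℤ d *ℤ + j))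
      ≈⟨ +-cong (*-congˡ (binomialSum-iterate H rel k n))
                (*-congˡ (binomialSum-iterate H rel k (n +ℤ d))) ⟩
    a * (c ^ k * H m) + b * (c ^ k * H ((n +ℤ d) +ℤ e *ℤ + k))
      ≈⟨ +-congˡ (*-congˡ (*-congˡ (reindex H (swap-shift n d e (+ k))))) ⟩
    a * (c ^ k * H m) + b * (c ^ k * H (m +ℤ d))
      ≈⟨ solve 5 (λ a b p x y → a :* (p :* x) :+ b :* (p :* y) := p :* (a :* x :+ b :* y))
               refl _ _ _ _ _ ⟩
    c ^ k * (a * H m + b * H (m +ℤ d))
      ≈⟨ *-congˡ (rel m) ⟩
    c ^ k * (c * H (m +ℤ e))
      ≈⟨ solve 3 (λ p c x → p :* (c :* x) := c :* p :* x) refl _ _ _ ⟩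
    c * c ^ k * H (m +ℤ e)
      ≈⟨ *-congˡ (reindex H (shift-end n e (+ k))) ⟩
    c ^ suc k * H (n +ℤ e *ℤ + suc k) ∎
    where
      m = n +ℤ e *ℤ + k
      shift-start : ∀ n d j → n +ℤ d *ℤ (+ 1 +ℤ j) ≡ (n +ℤ d) +ℤ d *ℤ j
      shift-start = solve-∀
      swap-shift : ∀ n d e k → (n +ℤ d) +ℤ e *ℤ k ≡ (n +ℤ e *ℤ k) +ℤ d
      swap-shift = solve-∀
      shift-end : ∀ n e k → (n +ℤ e *ℤ k) +ℤ e ≡ n +ℤ e *ℤ (+ 1 +ℤ k)
      shift-end = solve-∀

  fromℤ-neg : ∀ i → fromℤ (ℤ.- i) ≈ - fromℤ i
  fromℤ-neg (+ zero) = sym -0#≈0#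
  fromℤ-neg (+ suc n) = refl
  fromℤ-neg -[1+ n ] = sym (-‿involutive _)

  fromℤ-sgn : ∀ n m → fromℤ (sgn n ℤ.* + m) ≈ (- 1#) ^ n * fromℤ (+ m)
  fromℤ-sgn zero m = trans (reindex fromℤ (ℤ.*-identityˡ (+ m))) (sym (*-identityˡ _))
  fromℤ-sgn (suc n) m = begin
    fromℤ (ℤ.- sgn n ℤ.* + m)             ≈⟨ reindex fromℤ (ℤ.neg-distribˡ-* (sgn n) (+ m)) ⟨
    fromℤ (ℤ.- (sgn n ℤ.* + m))           ≈⟨ fromℤ-neg (sgn n ℤ.* + m) ⟩
    - fromℤ (sgn n ℤ.* + m)               ≈⟨ -‿cong (fromℤ-sgn n m) ⟩
    - ((- 1#) ^ n * fromℤ (+ m))          ≈⟨ -1*x≈-x _ ⟨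
    - 1# * ((- 1#) ^ n * fromℤ (+ m))     ≈⟨ *-assoc _ _ _ ⟨
    (- 1#) ^ suc n * fromℤ (+ m)          ∎

  F-isGenFib : IsGenFib F
  F-isGenFib (+ zero) = sym (-‿inverseʳ _)
  F-isGenFib (+ suc zero) = sym (+-identityˡ _)
  F-isGenFib (+ suc (suc m)) = ×-homo-+ 1# (fibℕ (suc m)) (fibℕ m)
  -- With ε = (-1)ᵐ, the values at -[1+ m ], -[1+ m+1 ], -[1+ m+2 ] are ε F(m+1), -ε F(m+2),
  -- ε F(m+3), so the recurrence there is F(m+3) = F(m+2) + F(m+1) in disguise.
  F-isGenFib -[1+ m ] = begin
    F -[1+ m ]
      ≈⟨ fromℤ-sgn m _ ⟩
    ε * F (+ suc m)
      ≈⟨ alternate (F (+ suc (suc m))) (F (+ suc m)) ⟩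
    (- 1# * ε) * F (+ suc (suc m)) + (- 1# * (- 1# * ε)) * (F (+ suc (suc m)) + F (+ suc m))
      ≈⟨ +-cong (sym (fromℤ-sgn (suc m) _))
                (trans (*-congˡ (sym (×-homo-+ 1# (fibℕ (suc (suc m))) (fibℕ (suc m)))))
                       (sym (fromℤ-sgn (suc (suc m)) _))) ⟩
    F -[1+ suc m ] + F -[1+ suc (suc m) ]
      ≈⟨ +-cong (reindex F (≡.cong (-[1+_] ∘ suc) (ℕ.+-identityʳ m)))
                (reindex F (≡.cong (-[1+_] ∘ suc) (ℕ.+-comm m 1))) ⟨
    F (-[1+ m ] -ℤ + 1) + F (-[1+ m ] -ℤ + 2) ∎
    where
      ε = (- 1#) ^ m
      alternate : ∀ x y → ε * y ≈ (- 1# * ε) * x + (- 1# * (- 1# * ε)) * (x + y)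
      alternate x y = sym (begin
        (- 1# * ε) * x + (- 1# * (- 1# * ε)) * (x + y)
          ≈⟨ +-cong (*-congʳ (-1*x≈-x ε))
                    (*-congʳ (trans (-1*x≈-x _) (trans (-‿cong (-1*x≈-x ε)) (-‿involutive ε)))) ⟩
        - ε * x + ε * (x + y)      ≈⟨ +-cong (-‿distribˡ-* ε x) (sym (distribˡ ε x y)) ⟨
        - (ε * x) + (ε * x + ε * y) ≈⟨ -x+[x+y]≈y _ _ ⟩
        ε * y                       ∎)

  isGenFib-cong : ∀ {G H : ℤ → Carrier} → (∀ r → G r ≈ H r) → IsGenFib G → IsGenFib H
  isGenFib-cong G≈H isG r = trans (sym (G≈H r)) (trans (isG r) (+-cong (G≈H _) (G≈H _)))

  isGenFib-shift : ∀ {G : ℤ → Carrier} → IsGenFib G → ∀ n → IsGenFib (λ r → G (n +ℤ r))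
  isGenFib-shift {G} isG n r =
    trans (isG (n +ℤ r)) (+-cong (reindex G (ℤ.+-assoc n r _)) (reindex G (ℤ.+-assoc n r _)))

  isGenFib-linear : ∀ {G H : ℤ → Carrier} → IsGenFib G → IsGenFib H →
    ∀ x y → IsGenFib (λ r → G r * x + H r * y)
  isGenFib-linear isG isH x y r =
    trans (+-cong (*-congʳ (isG r)) (*-congʳ (isH r)))
          (solve 6 (λ g g′ h h′ x y → (g :+ g′) :* x :+ (h :+ h′) :* y
                                      := (g :* x :+ h :* y) :+ (g′ :* x :+ h′ :* y))
                 refl _ _ _ _ _ _)

  genFib-step : ∀ {G : ℤ → Carrier} → IsGenFib G → ∀ r → G (r +ℤ + 1 +ℤ + 1) ≈ G (r +ℤ + 1) + G r
  genFib-step {G} isG r = trans (isG _) (+-cong (reindex G (back₁ r)) (reindex G (back₂ r)))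
    where
      back₁ : ∀ r → r +ℤ + 1 +ℤ + 1 -ℤ + 1 ≡ r +ℤ + 1
      back₁ = solve-∀
      back₂ : ∀ r → r +ℤ + 1 +ℤ + 1 -ℤ + 2 ≡ r
      back₂ = solve-∀

  genFib-unique : ∀ {G H : ℤ → Carrier} → IsGenFib G → IsGenFib H →
    G (+ 0) ≈ H (+ 0) → G (+ 1) ≈ H (+ 1) → ∀ r → G r ≈ H r
  genFib-unique {G} {H} isG isH G0≈H0 G1≈H1 = proj₁ ∘ ℤ-induction Agree (G0≈H0 , G1≈H1) up down
    where
      Agree : ℤ → Set ℓ
      Agree r = G r ≈ H r × G (r +ℤ + 1) ≈ H (r +ℤ + 1)

      up : ∀ r → Agree r → Agree (r +ℤ + 1)
      up r (G≈H , G′≈H′) = G′≈H′ , (begin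
        G (r +ℤ + 1 +ℤ + 1)    ≈⟨ genFib-step isG r ⟩
        G (r +ℤ + 1) + G r     ≈⟨ +-cong G′≈H′ G≈H ⟩
        H (r +ℤ + 1) + H r     ≈⟨ genFib-step isH r ⟨
        H (r +ℤ + 1 +ℤ + 1)    ∎)

      down : ∀ r → Agree (r +ℤ + 1) → Agree r
      down r (G′≈H′ , G″≈H″) = +-cancelˡ (H (r +ℤ + 1)) (G r) (H r) (begin
        H (r +ℤ + 1) + G r     ≈⟨ +-congʳ G′≈H′ ⟨
        G (r +ℤ + 1) + G r     ≈⟨ genFib-step isG r ⟨
        G (r +ℤ + 1 +ℤ + 1)    ≈⟨ G″≈H″ ⟩
        H (r +ℤ + 1 +ℤ + 1)    ≈⟨ genFib-step isH r ⟩
        H (r +ℤ + 1) + H r     ∎) , G′≈H′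

  genFib-addition : ∀ {G : ℤ → Carrier} → IsGenFib G →
    ∀ n s → G (n +ℤ s) ≈ F s * G (n +ℤ + 1) + F (s -ℤ + 1) * G n
  genFib-addition {G} isG n =
    genFib-unique (isGenFib-shift isG n) (isGenFib-linear F-isGenFib F[s-1]-isGenFib _ _) at-0 at-1
    where
      F[s-1]-isGenFib : IsGenFib (λ s → F (s -ℤ + 1))
      F[s-1]-isGenFib = isGenFib-cong (λ s → reindex F (ℤ.+-comm _ s)) (isGenFib-shift F-isGenFib (ℤ.- + 1))

      -- F (+ 0), F (+ 1) and F (- + 1) compute to 0#, 1# + 0# and 1# + 0#.
      at-0 : G (n +ℤ + 0) ≈ 0# * G (n +ℤ + 1) + (1# + 0#) * G n
      at-0 = trans (reindex G (ℤ.+-identityʳ n)) (sym (begin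
        0# * G (n +ℤ + 1) + (1# + 0#) * G n  ≈⟨ +-cong (zeroˡ _) (*-congʳ (+-identityʳ 1#)) ⟩
        0# + 1# * G n                        ≈⟨ +-identityˡ _ ⟩
        1# * G n                             ≈⟨ *-identityˡ _ ⟩
        G n                                  ∎))

      at-1 : G (n +ℤ + 1) ≈ (1# + 0#) * G (n +ℤ + 1) + 0# * G n
      at-1 = sym (begin
        (1# + 0#) * G (n +ℤ + 1) + 0# * G n  ≈⟨ +-cong (*-congʳ (+-identityʳ 1#)) (zeroˡ _) ⟩
        1# * G (n +ℤ + 1) + 0#               ≈⟨ +-identityʳ _ ⟩
        1# * G (n +ℤ + 1)                    ≈⟨ *-identityˡ _ ⟩
        G (n +ℤ + 1)                         ∎)

  module _ {G : ℤ → Carrier} (isG : IsGenFib G) where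

    binomial-identity-F[s-1]-alternating : ∀ k r s →
      sumTo k (λ j → (- 1#) ^ j * binom k j * F (s -ℤ + 1) ^ (k ∸ j) * G ((r -ℤ + k) +ℤ s *ℤ + j))
        ≈ (- 1#) ^ k * F s ^ k * G r
    binomial-identity-F[s-1]-alternating k r s = begin
      sumTo k (λ j → (- 1#) ^ j * binom k j * F (s -ℤ + 1) ^ (k ∸ j) * G ((r -ℤ + k) +ℤ s *ℤ + j))
        ≈⟨ sumTo-cong k (λ j →
             solve 4 (λ w p q v → w :* p :* q :* v := p :* q :* w :* v) refl _ _ _ _) ⟩
      binomialSum k (F (s -ℤ + 1)) (- 1#) (λ j → G ((r -ℤ + k) +ℤ s *ℤ + j))
        ≈⟨ binomialSum-iterate G relation k (r -ℤ + k) ⟩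
      (- F s) ^ k * G ((r -ℤ + k) +ℤ + 1 *ℤ + k)
        ≈⟨ *-cong ([-x]^n≈[-1]^n*x^n (F s) k) (reindex G (cancel r (+ k))) ⟩
      (- 1#) ^ k * F s ^ k * G r ∎
      where
        cancel : ∀ r k → (r -ℤ k) +ℤ + 1 *ℤ k ≡ r
        cancel = solve-∀

        relation : ∀ n → F (s -ℤ + 1) * G n + - 1# * G (n +ℤ s) ≈ - F s * G (n +ℤ + 1)
        relation n = begin
          y + - 1# * G (n +ℤ s)  ≈⟨ +-congˡ (trans (-1*x≈-x _) (-‿cong (genFib-addition isG n s))) ⟩
          y + - (x + y)          ≈⟨ +-congˡ (⁻¹-∙-comm x y) ⟨
          y + (- x + - y)        ≈⟨ solve 3 (λ y X Y → y :+ (X :+ Y) := X :+ (y :+ Y)) refl _ _ _ ⟩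
          - x + (y + - y)        ≈⟨ +-congˡ (-‿inverseʳ y) ⟩
          - x + 0#               ≈⟨ +-identityʳ _ ⟩
          - x                    ≈⟨ -‿distribˡ-* _ _ ⟩
          - F s * G (n +ℤ + 1)   ∎
          where
            x = F s * G (n +ℤ + 1)
            y = F (s -ℤ + 1) * G n

    binomial-identity-F[s-1]-F[s] : ∀ k r s →
      sumTo k (λ j → binom k j * F (s -ℤ + 1) ^ (k ∸ j) * F s ^ j * G ((r -ℤ s *ℤ + k) +ℤ + j))
        ≈ G r
    binomial-identity-F[s-1]-F[s] k r s = begin
      binomialSum k (F (s -ℤ + 1)) (F s) (λ j → G ((r -ℤ s *ℤ + k) +ℤ + j))
        ≈⟨ binomialSum-cong k _ _ (λ j → reindex G (+-1* (r -ℤ s *ℤ + k) (+ j))) ⟨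
      binomialSum k (F (s -ℤ + 1)) (F s) (λ j → G ((r -ℤ s *ℤ + k) +ℤ + 1 *ℤ + j))
        ≈⟨ binomialSum-iterate G relation k (r -ℤ s *ℤ + k) ⟩
      1# ^ k * G ((r -ℤ s *ℤ + k) +ℤ s *ℤ + k)
        ≈⟨ *-cong (1^n≈1 k) (reindex G (cancel r s (+ k))) ⟩
      1# * G r
        ≈⟨ *-identityˡ _ ⟩
      G r ∎
      where
        +-1* : ∀ n j → n +ℤ + 1 *ℤ j ≡ n +ℤ j
        +-1* = solve-∀
        cancel : ∀ r s k → (r -ℤ s *ℤ k) +ℤ s *ℤ k ≡ r
        cancel = solve-∀

        relation : ∀ n → F (s -ℤ + 1) * G n + F s * G (n +ℤ + 1) ≈ 1# * G (n +ℤ s)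
        relation n = trans (+-comm _ _) (sym (trans (*-identityˡ _) (genFib-addition isG n s)))

    binomial-identity-F[s+1]-alternating : ∀ k r s →
      sumTo k (λ j → (- 1#) ^ (k ∸ j) * binom k j * F (s +ℤ + 1) ^ (k ∸ j) * G ((r +ℤ + k) +ℤ s *ℤ + j))
        ≈ F s ^ k * G r
    binomial-identity-F[s+1]-alternating k r s = begin
      sumTo k (λ j → (- 1#) ^ (k ∸ j) * binom k j * F (s +ℤ + 1) ^ (k ∸ j) * G ((r +ℤ + k) +ℤ s *ℤ + j))
        ≈⟨ sumTo-cong k termwise ⟩
      binomialSum k (- F (s +ℤ + 1)) 1# (λ j → G ((r +ℤ + k) +ℤ s *ℤ + j))
        ≈⟨ binomialSum-iterate G relation k (r +ℤ + k) ⟩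
      F s ^ k * G ((r +ℤ + k) +ℤ ℤ.- + 1 *ℤ + k)
        ≈⟨ *-congˡ (reindex G (cancel r (+ k))) ⟩
      F s ^ k * G r ∎
      where
        cancel : ∀ r k → (r +ℤ k) +ℤ ℤ.- + 1 *ℤ k ≡ r
        cancel = solve-∀
        shift-back : ∀ n s → (n -ℤ + 1) +ℤ (s +ℤ + 1) ≡ n +ℤ s
        shift-back = solve-∀
        back-forth : ∀ n → (n -ℤ + 1) +ℤ + 1 ≡ n
        back-forth = solve-∀
        forth-back : ∀ s → (s +ℤ + 1) -ℤ + 1 ≡ s
        forth-back = solve-∀

        termwise : ∀ j →
          (- 1#) ^ (k ∸ j) * binom k j * F (s +ℤ + 1) ^ (k ∸ j) * G ((r +ℤ + k) +ℤ s *ℤ + j)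
            ≈ binomialTerm k (- F (s +ℤ + 1)) 1# (λ j → G ((r +ℤ + k) +ℤ s *ℤ + j)) j
        termwise j = trans
          (solve 4 (λ w p q v → w :* p :* q :* v := p :* (w :* q) :* v) refl _ _ _ _)
          (*-congʳ (trans (*-congˡ (sym ([-x]^n≈[-1]^n*x^n _ (k ∸ j))))
                          (trans (sym (*-identityʳ _)) (*-congˡ (sym (1^n≈1 j))))))

        relation : ∀ n → - F (s +ℤ + 1) * G n + 1# * G (n +ℤ s) ≈ F s * G (n -ℤ + 1)
        relation n = begin
          - F (s +ℤ + 1) * G n + 1# * G (n +ℤ s)
            ≈⟨ +-cong (-‿distribˡ-* _ _) (sym (*-identityˡ _)) ⟨
          - (F (s +ℤ + 1) * G n) + G (n +ℤ s)
            ≈⟨ +-congˡ (reindex G (shift-back n s)) ⟨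
          - (F (s +ℤ + 1) * G n) + G ((n -ℤ + 1) +ℤ (s +ℤ + 1))
            ≈⟨ +-congˡ (genFib-addition isG (n -ℤ + 1) (s +ℤ + 1)) ⟩
          - (F (s +ℤ + 1) * G n)
            + (F (s +ℤ + 1) * G ((n -ℤ + 1) +ℤ + 1) + F ((s +ℤ + 1) -ℤ + 1) * G (n -ℤ + 1))
            ≈⟨ +-congˡ (+-cong (*-congˡ (reindex G (back-forth n)))
                               (*-congʳ (reindex F (forth-back s)))) ⟩
          - (F (s +ℤ + 1) * G n) + (F (s +ℤ + 1) * G n + F s * G (n -ℤ + 1))
            ≈⟨ -x+[x+y]≈y _ _ ⟩
          F s * G (n -ℤ + 1) ∎

theorem9 : ∀ {c ℓ} (R : CommutativeRing c ℓ) →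
    let open FibDefs R in
    (G : ℤ → Carrier) → IsGenFib G → (k : ℕ) (r s : ℤ) →
      (sumTo k (λ j → ((- 1#) ^ j) * binom k j * (F (s -ℤ + 1) ^ (k ∸ j)) * G ((r -ℤ + k) +ℤ s *ℤ + j))
          ≈ ((- 1#) ^ k) * (F s ^ k) * G r)
      × (sumTo k (λ j → binom k j * (F (s -ℤ + 1) ^ (k ∸ j)) * (F s ^ j) * G ((r -ℤ s *ℤ + k) +ℤ + j))
          ≈ G r)
      × (sumTo k (λ j → ((- 1#) ^ (k ∸ j)) * binom k j * (F (s +ℤ + 1) ^ (k ∸ j)) * G ((r +ℤ + k) +ℤ s *ℤ + j))
          ≈ (F s ^ k) * G r)
theorem9 R G isG k r s =
    binomial-identity-F[s-1]-alternating isG k r s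
  , binomial-identity-F[s-1]-F[s] isG k r s
  , binomial-identity-F[s+1]-alternating isG k r s
  where open FibonacciIdentities R
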